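{- Let $x\geq 4$ be an even integer. Then for all integers $b\geq 0$ and all $0\leq s\leq x$ there exists a standard linear realization of the list $\{1^{2x-1},x^b,(x+1)^s\}$.
   Context: The notation $\{1^{a_1},\ldots,t^{a_t}\}$ denotes the multiset with $a_i$ copies of $i$. For a list (multiset) $L$ of positive integers with $|L|$ elements, a linear realization of $L$ is an ordering $[x_0,\ldots,x_{|L|}]$ of $\{0,1,\ldots,|L|\}$ such that the multiset $\{|x_i-x_{i+1}|:0\le i\le |L|-1\}$ equals $L$; it is standard if $x_0=0$. -}

module Defs where

open import Data.Nat using (ℕ; zero; suc; _+_; _∸_; ∣_-_∣)
open import Data.List using (List; []; _∷_; length; upTo; replicate; _++_)
open import Data.List.Relation.Binary.Permutation.Propositional using (_↭_)
open import Data.Product using (_×_; Σ)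
open import Relation.Binary.PropositionalEquality using (_≡_)

diffs : List ℕ → List ℕ
diffs [] = []
diffs (a ∷ []) = []
diffs (a ∷ b ∷ rest) = ∣ a - b ∣ ∷ diffs (b ∷ rest)

-- xs is a linear realization of the multiset L (given as a list up to permutation):
-- xs is an ordering of {0,1,...,|L|} and the multiset of consecutive
-- absolute differences equals L.
LinearRealization : List ℕ → List ℕ → Set
LinearRealization L xs = (xs ↭ upTo (suc (length L))) × (diffs xs ↭ L)

StandardLinearRealization : List ℕ → List ℕ → Set
StandardLinearRealization L xs = LinearRealization L xs × (Σ (List ℕ) λ ys → xs ≡ 0 ∷ ys)

theList : ℕ → ℕ → ℕ → List ℕ
theList x b s = replicate (2 * x ∸ 1) 1 ++ replicate b x ++ replicate s (suc x)
  where open import Data.Nat using (_*_)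

-- The proof grows realizations by one local move (the
-- extension lemma): if the consecutive values c, c+1 stand next to each
-- other in a realization on [0, n] and c + d = n + 1, then inserting
-- c+d, c+d+1 between them yields a realization on [0, n+2] of the list with
-- two more copies of d, in which c+d, c+d+1 again stand next to each other.
-- A "frame" is a realization together with reserved edges above an offset
-- `low`: x-edges at low+1, low+3, ..., low+x-1 (used for d = x) and k
-- s-edges at low, low+2, ... (used for d = x+1).  Using the lowest reserved
-- edge and raising `low` by two turns a frame back into a frame, so from one
-- frame we obtain all lists with b and s raised by even amounts (as long as
-- s-edges remain).  Five explicit base frames, assembled from monotone runs,
-- cover the parities of b and s, and the theorem follows by halving b and s.

module Submission where

open import Defs
open import Data.Nat using (ℕ; zero; suc; pred; _+_; _*_; _∸_; _≤_; _<_; z≤n; s≤s; ∣_-_∣)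
open import Data.Nat.Properties
  using (+-suc; +-comm; +-identityʳ; +-cancelˡ-≡; +-monoʳ-<; *-monoˡ-≤; *-cancelʳ-≤;
         ≤-trans; n≤1+n; m≤m+n; m≤n⇒m<n∨m≡n; m+[n∸m]≡n; ∣m-m+n∣≡n; ∣-∣-comm)
open import Data.Nat.Divisibility using (_∣_; divides)
open import Data.Nat.Tactic.RingSolver using (solve-∀)
open import Data.List using (List; []; _∷_; _++_; _∷ʳ_; [_]; length; upTo; replicate)
open import Data.List.Properties using (++-assoc; ++-identityʳ; upTo-∷ʳ; length-upTo)
open import Data.List.Relation.Binary.Permutation.Propositional
  using (_↭_; ↭-refl; ↭-prep; ↭-swap; ↭-sym; ↭-trans; ↭-reflexive; module PermutationReasoning)
open import Data.List.Relation.Binary.Permutation.Propositional.Properties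
  using (shift; shifts; ++⁺ˡ; ++⁺ʳ; ↭-length; ∷↭∷ʳ)
  renaming (++-comm to ↭-++-comm)
open import Data.Product using (Σ; _,_)
open import Data.Sum using (inj₁; inj₂)
open import Data.Empty using (⊥-elim)
open import Relation.Binary.PropositionalEquality
  using (_≡_; _≢_; refl; sym; trans; cong; cong₂; subst; subst₂; module ≡-Reasoning)

length-diffs : ∀ xs → length (diffs xs) ≡ pred (length xs)
length-diffs []            = refl
length-diffs (a ∷ [])      = refl
length-diffs (a ∷ b ∷ xs)  = cong suc (length-diffs (b ∷ xs))

diffs-++ : ∀ pre p rest → diffs (pre ++ p ∷ rest) ≡ diffs (pre ∷ʳ p) ++ diffs (p ∷ rest)
diffs-++ []            p rest = refl
diffs-++ (a ∷ [])      p rest = refl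
diffs-++ (a ∷ b ∷ pre) p rest = cong (∣ a - b ∣ ∷_) (diffs-++ (b ∷ pre) p rest)

∣n-1+n∣≡1 : ∀ n → ∣ n - suc n ∣ ≡ 1
∣n-1+n∣≡1 zero    = refl
∣n-1+n∣≡1 (suc n) = ∣n-1+n∣≡1 n

∣1+n-n∣≡1 : ∀ n → ∣ suc n - n ∣ ≡ 1
∣1+n-n∣≡1 n = trans (∣-∣-comm (suc n) n) (∣n-1+n∣≡1 n)

record Realization (n : ℕ) (L xs : List ℕ) : Set where
  field
    covers      : xs ↭ upTo (suc n)
    differences : diffs xs ↭ L
    startsAt0   : Σ (List ℕ) λ ys → xs ≡ 0 ∷ ys

retarget : ∀ {n L L′ xs} → L ↭ L′ → Realization n L xs → Realization n L′ xs
retarget L↭L′ R = record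
  { covers = covers ; differences = ↭-trans differences L↭L′ ; startsAt0 = startsAt0 }
  where open Realization R

standard : ∀ {n L xs} → Realization n L xs → StandardLinearRealization L xs
standard {n} {L} {xs} R =
  (subst (λ k → xs ↭ upTo (suc k)) (sym |L|≡n) covers , differences) , startsAt0
  where
  open Realization R
  open ≡-Reasoning
  |L|≡n : length L ≡ n
  |L|≡n = begin
    length L                      ≡⟨ sym (↭-length differences) ⟩
    length (diffs xs)             ≡⟨ length-diffs xs ⟩
    pred (length xs)              ≡⟨ cong pred (↭-length covers) ⟩
    pred (length (upTo (suc n)))  ≡⟨ cong pred (length-upTo (suc n)) ⟩
    n                             ∎

data Adj (c d : ℕ) : List ℕ → Set where
  here  : ∀ {xs} → Adj c d (c ∷ d ∷ xs)
  there : ∀ {y xs} → Adj c d xs → Adj c d (y ∷ xs)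

adj-split : ∀ {c d xs} → Adj c d xs →
  Σ (List ℕ) λ pre → Σ (List ℕ) λ post → xs ≡ pre ++ c ∷ d ∷ post
adj-split (here {xs}) = [] , xs , refl
adj-split (there {y} a) with adj-split a
... | pre , post , eq = y ∷ pre , post , cong (y ∷_) eq

adj-++⁺ˡ : ∀ {c d xs} ys → Adj c d xs → Adj c d (xs ++ ys)
adj-++⁺ˡ ys here      = here
adj-++⁺ˡ ys (there a) = there (adj-++⁺ˡ ys a)

adj-++⁺ʳ : ∀ {c d xs} ys → Adj c d xs → Adj c d (ys ++ xs)
adj-++⁺ʳ []       a = a
adj-++⁺ʳ (y ∷ ys) a = there (adj-++⁺ʳ ys a)

module Insertion (pre : List ℕ) (p u v q : ℕ) (post : List ℕ) where

  before after : List ℕ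
  before = pre ++ p ∷ q ∷ post
  after  = pre ++ p ∷ u ∷ v ∷ q ∷ post

  insert-↭ : after ↭ u ∷ v ∷ before
  insert-↭ = begin
      pre ++ p ∷ u ∷ v ∷ q ∷ post
    ≡⟨ sym (++-assoc pre [ p ] _) ⟩
      (pre ∷ʳ p) ++ (u ∷ v ∷ []) ++ q ∷ post
    ↭⟨ shifts (pre ∷ʳ p) (u ∷ v ∷ []) ⟩
      u ∷ v ∷ (pre ∷ʳ p) ++ q ∷ post
    ≡⟨ cong (λ t → u ∷ v ∷ t) (++-assoc pre [ p ] _) ⟩
      u ∷ v ∷ before ∎
    where open PermutationReasoning

  insert-diffs : ∣ u - v ∣ ≡ ∣ p - q ∣ → diffs after ↭ ∣ p - u ∣ ∷ ∣ v - q ∣ ∷ diffs before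
  insert-diffs gap = begin
      diffs after
    ≡⟨ diffs-++ pre p _ ⟩
      D ++ ∣ p - u ∣ ∷ ∣ u - v ∣ ∷ ∣ v - q ∣ ∷ R
    ≡⟨ cong (λ t → D ++ ∣ p - u ∣ ∷ t ∷ ∣ v - q ∣ ∷ R) gap ⟩
      D ++ [ ∣ p - u ∣ ] ++ ∣ p - q ∣ ∷ ∣ v - q ∣ ∷ R
    ↭⟨ shift ∣ p - u ∣ D _ ⟩
      ∣ p - u ∣ ∷ D ++ ∣ p - q ∣ ∷ ∣ v - q ∣ ∷ R
    ↭⟨ ↭-prep _ (++⁺ˡ D (↭-swap _ _ ↭-refl)) ⟩
      ∣ p - u ∣ ∷ D ++ [ ∣ v - q ∣ ] ++ ∣ p - q ∣ ∷ R
    ↭⟨ ↭-prep _ (shift ∣ v - q ∣ D _) ⟩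
      ∣ p - u ∣ ∷ ∣ v - q ∣ ∷ D ++ ∣ p - q ∣ ∷ R
    ≡⟨ cong (λ t → ∣ p - u ∣ ∷ ∣ v - q ∣ ∷ t) (sym (diffs-++ pre p _)) ⟩
      ∣ p - u ∣ ∷ ∣ v - q ∣ ∷ diffs before ∎
    where
    open PermutationReasoning
    D = diffs (pre ∷ʳ p)
    R = diffs (q ∷ post)

  insert-head : ∀ {ys} → before ≡ 0 ∷ ys → Σ (List ℕ) λ ys′ → after ≡ 0 ∷ ys′
  insert-head = go pre
    where
    go : ∀ pre {ys} → pre ++ p ∷ q ∷ post ≡ 0 ∷ ys →
         Σ (List ℕ) λ ys′ → pre ++ p ∷ u ∷ v ∷ q ∷ post ≡ 0 ∷ ys′
    go []       refl = u ∷ v ∷ q ∷ post , refl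
    go (_ ∷ ws) refl = ws ++ p ∷ u ∷ v ∷ q ∷ post , refl

  insert-keeps : ∀ {c d} → c ≢ p → Adj c d before → Adj c d after
  insert-keeps = go pre
    where
    go : ∀ {c d} pre → c ≢ p →
         Adj c d (pre ++ p ∷ q ∷ post) → Adj c d (pre ++ p ∷ u ∷ v ∷ q ∷ post)
    go []           c≢p here      = ⊥-elim (c≢p refl)
    go []           c≢p (there a) = there (there (there a))
    go (_ ∷ [])     c≢p here      = here
    go (_ ∷ _ ∷ ws) c≢p here      = here
    go (_ ∷ ws)     c≢p (there a) = there (go ws c≢p a)

  insert-new : Adj u v after
  insert-new = go pre
    where
    go : ∀ pre → Adj u v (pre ++ p ∷ u ∷ v ∷ q ∷ post)
    go []       = there here
    go (_ ∷ ws) = there (go ws)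

data Orientation : Set where
  ascending descending : Orientation

first second : Orientation → ℕ → ℕ
first  ascending  c = c
first  descending c = suc c
second ascending  c = suc c
second descending c = c

Edge : Orientation → ℕ → List ℕ → Set
Edge o c = Adj (first o c) (second o c)

first-+ : ∀ o c d → first o (c + d) ≡ first o c + d
first-+ ascending  c d = refl
first-+ descending c d = refl

second-+ : ∀ o c d → second o (c + d) ≡ second o c + d
second-+ ascending  c d = refl
second-+ descending c d = refl

edge-gap : ∀ o c → ∣ first o c - second o c ∣ ≡ 1
edge-gap ascending  c = ∣n-1+n∣≡1 c
edge-gap descending c = ∣1+n-n∣≡1 c

first-injective : ∀ o {c c′} → first o c ≡ first o c′ → c ≡ c′
first-injective ascending  refl = refl
first-injective descending refl = refl

edge-values : ∀ o n → first o n ∷ second o n ∷ upTo n ↭ upTo (suc (suc n))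
edge-values ascending n = begin
    n ∷ suc n ∷ upTo n               ↭⟨ ↭-++-comm (n ∷ suc n ∷ []) (upTo n) ⟩
    upTo n ++ n ∷ suc n ∷ []         ≡⟨ sym (++-assoc (upTo n) [ n ] [ suc n ]) ⟩
    (upTo n ∷ʳ n) ∷ʳ suc n           ≡⟨ cong (_∷ʳ suc n) (upTo-∷ʳ n) ⟩
    upTo (suc n) ∷ʳ suc n            ≡⟨ upTo-∷ʳ (suc n) ⟩
    upTo (suc (suc n))               ∎
  where open PermutationReasoning
edge-values descending n = ↭-trans (↭-swap (suc n) n ↭-refl) (edge-values ascending n)

-- Let xs realize L on [0, n] and have an edge at c, where
-- c + d = n + 1.  Inserting the new values n+1, n+2, ordered as an edge of
-- the same orientation, between the two values of the edge at c gives a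
-- realization of d ∷ d ∷ L on [0, n+2]: the outer differences are both d and
-- the inner one is 1 like the difference it replaces.

record Extension (o : Orientation) (c d n : ℕ) (L xs : List ℕ) : Set where
  field
    list        : List ℕ
    realization : Realization (suc (suc n)) (d ∷ d ∷ L) list
    preserves   : ∀ {c′} → c′ ≢ c → Edge o c′ xs → Edge o c′ list
    created     : Edge o (suc n) list

extend : ∀ {o c n L xs} d → c + d ≡ suc n → Realization n L xs → Edge o c xs → Extension o c d n L xs
extend {o} {c} {n} {L} d c+d≡1+n R e with adj-split e
... | pre , post , refl = record
  { list        = after
  ; realization = record
    { covers      = ↭-trans insert-↭ (↭-trans (↭-prep _ (↭-prep _ covers)) new-values)
    ; differences = ↭-trans (insert-diffs (trans (edge-gap o (c + d)) (sym (edge-gap o c))))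
                            (subst₂ (λ δ δ′ → δ ∷ δ′ ∷ diffs before ↭ d ∷ d ∷ L)
                                    (sym left-jump) (sym right-jump) (↭-prep d (↭-prep d differences)))
    ; startsAt0   = let (ys , eq) = startsAt0 in insert-head eq
    }
  ; preserves   = λ c′≢c → insert-keeps (λ eq → c′≢c (first-injective o eq))
  ; created     = subst (λ t → Edge o t after) c+d≡1+n insert-new
  }
  where
  open Realization R
  open Insertion pre (first o c) (first o (c + d)) (second o (c + d)) (second o c) post
  new-values : first o (c + d) ∷ second o (c + d) ∷ upTo (suc n) ↭ upTo (suc (suc (suc n)))
  new-values = subst (λ t → first o t ∷ second o t ∷ upTo (suc n) ↭ upTo (suc (suc (suc n))))
                     (sym c+d≡1+n) (edge-values o (suc n))
  left-jump : ∣ first o c - first o (c + d) ∣ ≡ d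
  left-jump = trans (cong (∣ first o c -_∣) (first-+ o c d)) (∣m-m+n∣≡n (first o c) d)
  right-jump : ∣ second o (c + d) - second o c ∣ ≡ d
  right-jump = trans (cong ∣_- second o c ∣ (second-+ o c d))
                     (trans (∣-∣-comm (second o c + d) (second o c)) (∣m-m+n∣≡n (second o c) d))

-- The target list.  For x = y + 1, theList x b s is, up to order,
-- x^b (x+1)^s 1^(y+x): the form in which the base constructions produce it.

replicate-++ : ∀ {A : Set} a c (v : A) → replicate a v ++ replicate c v ≡ replicate (a + c) v
replicate-++ zero    c v = refl
replicate-++ (suc a) c v = cong (v ∷_) (replicate-++ a c v)

theList-↭ : ∀ y b s →
  theList (suc y) b s ↭ replicate b (suc y) ++ replicate s (suc (suc y)) ++ replicate (y + suc y) 1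
theList-↭ y b s = begin
    ones ++ replicate b (suc y) ++ replicate s (suc (suc y))
  ↭⟨ ↭-++-comm ones _ ⟩
    (replicate b (suc y) ++ replicate s (suc (suc y))) ++ ones
  ≡⟨ ++-assoc (replicate b (suc y)) _ ones ⟩
    replicate b (suc y) ++ replicate s (suc (suc y)) ++ ones
  ≡⟨ cong (λ t → replicate b (suc y) ++ replicate s (suc (suc y)) ++ replicate t 1)
          (cong (y +_) (+-identityʳ (suc y))) ⟩
    replicate b (suc y) ++ replicate s (suc (suc y)) ++ replicate (y + suc y) 1 ∎
  where
  open PermutationReasoning
  ones : List ℕ
  ones = replicate (2 * suc y ∸ 1) 1

theList-x∷x : ∀ x b s → theList x (suc (suc b)) s ↭ x ∷ x ∷ theList x b s
theList-x∷x x b s = shifts (replicate (2 * x ∸ 1) 1) (x ∷ x ∷ [])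

theList-x+1∷x+1 : ∀ x b s → theList x b (suc (suc s)) ↭ suc x ∷ suc x ∷ theList x b s
theList-x+1∷x+1 x b s =
  ↭-trans (++⁺ˡ (replicate (2 * x ∸ 1) 1) (shifts (replicate b x) (suc x ∷ suc x ∷ [])))
          (shifts (replicate (2 * x ∸ 1) 1) (suc x ∷ suc x ∷ []))

record Frame (p b s k : ℕ) (o : Orientation) : Set where
  field
    low         : ℕ
    list        : List ℕ
    realization : Realization (low + suc p * 2) (theList (suc p * 2) b s) list
    xEdges      : ∀ j → j < suc p → Edge o (low + suc (j * 2)) list
    sEdges      : ∀ j → j < k → Edge o (low + j * 2) list

forget-sEdges : ∀ {p b s k o} → Frame p b s k o → Frame p b s 0 o
forget-sEdges F = record { Frame F ; sEdges = λ _ () }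

offset-≢ : ∀ low {i i′} → i ≢ i′ → low + i ≢ low + i′
offset-≢ low i≢i′ eq = i≢i′ (+-cancelˡ-≡ low _ _ eq)

advance-xEdges : ∀ {o p low c d L xs} (E : Extension o c d (low + suc p * 2) L xs) →
  (∀ j → low + suc (suc j * 2) ≢ c) →
  (∀ j → j < suc p → Edge o (low + suc (j * 2)) xs) →
  ∀ j → j < suc p → Edge o (suc (suc low) + suc (j * 2)) (Extension.list E)
advance-xEdges {o} {p} {low} E below xEdges j j<1+p with m≤n⇒m<n∨m≡n j<1+p
... | inj₁ 1+j<1+p =
  subst (λ t → Edge o t list) (shifted low j) (preserves (below j) (xEdges (suc j) 1+j<1+p))
  where
  open Extension E
  shifted : ∀ low j → low + suc (suc j * 2) ≡ suc (suc low) + suc (j * 2)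
  shifted = solve-∀
... | inj₂ refl = subst (λ t → Edge o t list) (top low p) created
  where
  open Extension E
  top : ∀ low p → suc (low + suc p * 2) ≡ suc (suc low) + suc (p * 2)
  top = solve-∀

x-step : ∀ {p b s k o} → Frame p b s k o → Frame p (suc (suc b)) s 0 o
x-step {p} {b} {s} {o = o} F = record
  { low         = suc (suc low)
  ; list        = Extension.list E
  ; realization = retarget (↭-sym (theList-x∷x (suc p * 2) b s)) (Extension.realization E)
  ; xEdges      = advance-xEdges E (λ j → offset-≢ low λ ()) xEdges
  ; sEdges      = λ _ ()
  }
  where
  open Frame F
  reaches-top : ∀ low p → (low + 1) + suc p * 2 ≡ suc (low + suc p * 2)
  reaches-top = solve-∀
  E : Extension o (low + 1) (suc p * 2) (low + suc p * 2) (theList (suc p * 2) b s) list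
  E = extend (suc p * 2) (reaches-top low p) realization (xEdges 0 (s≤s z≤n))

s-step : ∀ {p b s k o} → Frame p b s (suc k) o → Frame p b (suc (suc s)) k o
s-step {p} {b} {s} {k} {o} F = record
  { low         = suc (suc low)
  ; list        = Extension.list E
  ; realization = retarget (↭-sym (theList-x+1∷x+1 (suc p * 2) b s)) (Extension.realization E)
  ; xEdges      = advance-xEdges E (λ j → offset-≢ low λ ()) xEdges
  ; sEdges      = sEdges′
  }
  where
  open Frame F
  reaches-top : ∀ low p → (low + 0) + suc (suc p * 2) ≡ suc (low + suc p * 2)
  reaches-top = solve-∀
  E : Extension o (low + 0) (suc (suc p * 2)) (low + suc p * 2) (theList (suc p * 2) b s) list
  E = extend (suc (suc p * 2)) (reaches-top low p) realization (sEdges 0 (s≤s z≤n))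
  shifted : ∀ low j → low + suc j * 2 ≡ suc (suc low) + j * 2
  shifted = solve-∀
  sEdges′ : ∀ j → j < k → Edge o (suc (suc low) + j * 2) (Extension.list E)
  sEdges′ j j<k = subst (λ t → Edge o t (Extension.list E)) (shifted low j)
                        (Extension.preserves E (offset-≢ low λ ()) (sEdges (suc j) (s≤s j<k)))

-- Iterating the two steps; the s-steps come first, while s-edges remain.
add-x-pairs : ∀ {p b s o} β → Frame p b s 0 o → Frame p (β * 2 + b) s 0 o
add-x-pairs zero    F = F
add-x-pairs (suc β) F = x-step (add-x-pairs β F)

add-s-pairs : ∀ {p b s o} σ {k} → Frame p b s (σ + k) o → Frame p b (σ * 2 + s) k o
add-s-pairs             zero    F = F
add-s-pairs {p} {b} {s} {o} (suc σ) {k} F =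
  s-step (add-s-pairs σ (subst (λ t → Frame p b s t o) (sym (+-suc σ k)) F))

complete : ∀ {p b s k o} β σ → σ ≤ k → Frame p b s k o →
  Σ (List ℕ) (StandardLinearRealization (theList (suc p * 2) (β * 2 + b) (σ * 2 + s)))
complete {p} {b} {s} {k} {o} β σ σ≤k F =
  Frame.list grown , standard (Frame.realization grown)
  where
  k≡σ+[k∸σ] : k ≡ σ + (k ∸ σ)
  k≡σ+[k∸σ] = sym (m+[n∸m]≡n σ≤k)
  grown : Frame p (β * 2 + b) (σ * 2 + s) 0 o
  grown = add-x-pairs β (forget-sEdges (add-s-pairs σ (subst (λ t → Frame p b s t o) k≡σ+[k∸σ] F)))

up : ℕ → ℕ → List ℕ
up a zero    = []
up a (suc l) = a ∷ up (suc a) l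

down : ℕ → ℕ → List ℕ
down a zero    = []
down a (suc l) = a + l ∷ down a l

up-++ : ∀ a l l′ → up a (l + l′) ≡ up a l ++ up (a + l) l′
up-++ a zero    l′ = cong (λ t → up t l′) (sym (+-identityʳ a))
up-++ a (suc l) l′ = cong (a ∷_)
  (trans (up-++ (suc a) l l′) (cong (λ t → up (suc a) l ++ up t l′) (sym (+-suc a l))))

up-∷ʳ : ∀ a l → up a (suc l) ≡ up a l ∷ʳ (a + l)
up-∷ʳ a l = trans (cong (up a) (+-comm 1 l)) (up-++ a l 1)

upTo-up : ∀ n → upTo n ≡ up 0 n
upTo-up zero    = refl
upTo-up (suc n) = trans (sym (upTo-∷ʳ n)) (trans (cong (_∷ʳ n) (upTo-up n)) (sym (up-∷ʳ 0 n)))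

down↭up : ∀ a l → down a l ↭ up a l
down↭up a zero    = ↭-refl
down↭up a (suc l) = ↭-trans (↭-prep (a + l) (down↭up a l))
                            (↭-trans (∷↭∷ʳ (a + l) (up a l)) (↭-reflexive (sym (up-∷ʳ a l))))

diffs-up-++ : ∀ a l rest → diffs (up a (suc l) ++ rest) ≡ replicate l 1 ++ diffs (a + l ∷ rest)
diffs-up-++ a zero    rest = cong (λ t → diffs (t ∷ rest)) (sym (+-identityʳ a))
diffs-up-++ a (suc l) rest = cong₂ _∷_ (∣n-1+n∣≡1 a)
  (trans (diffs-up-++ (suc a) l rest) (cong (λ t → replicate l 1 ++ diffs (t ∷ rest)) (sym (+-suc a l))))

diffs-down-++ : ∀ a l rest → diffs (down a (suc l) ++ rest) ≡ replicate l 1 ++ diffs (a ∷ rest)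
diffs-down-++ a zero    rest = cong (λ t → diffs (t ∷ rest)) (+-identityʳ a)
diffs-down-++ a (suc l) rest = cong₂ _∷_ (trans (cong ∣_- a + l ∣ (+-suc a l)) (∣1+n-n∣≡1 (a + l)))
                                         (diffs-down-++ a l rest)

diffs-up : ∀ a l → diffs (up a (suc l)) ≡ replicate l 1
diffs-up a l = begin
  diffs (up a (suc l))              ≡⟨ cong diffs (sym (++-identityʳ (up a (suc l)))) ⟩
  diffs (up a (suc l) ++ [])        ≡⟨ diffs-up-++ a l [] ⟩
  replicate l 1 ++ []               ≡⟨ ++-identityʳ (replicate l 1) ⟩
  replicate l 1                     ∎
  where open ≡-Reasoning

diffs-down : ∀ a l → diffs (down a (suc l)) ≡ replicate l 1
diffs-down a l = begin
  diffs (down a (suc l))            ≡⟨ cong diffs (sym (++-identityʳ (down a (suc l)))) ⟩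
  diffs (down a (suc l) ++ [])      ≡⟨ diffs-down-++ a l [] ⟩
  replicate l 1 ++ []               ≡⟨ ++-identityʳ (replicate l 1) ⟩
  replicate l 1                     ∎
  where open ≡-Reasoning

record EdgeBlock (o : Orientation) (a l : ℕ) (xs : List ℕ) : Set where
  constructor block
  field edgeAt : ∀ i → i < l → Edge o (a + i) xs

up-edges : ∀ a l → EdgeBlock ascending a l (up a (suc l))
up-edges a l = block (edge a l)
  where
  edge : ∀ a l i → i < l → Edge ascending (a + i) (up a (suc l))
  edge a (suc l) zero    _         =
    subst (λ t → Adj t (suc t) (up a (suc (suc l)))) (sym (+-identityʳ a)) here
  edge a (suc l) (suc i) (s≤s i<l) =
    there (subst (λ t → Adj t (suc t) (up (suc a) (suc l))) (sym (+-suc a i)) (edge (suc a) l i i<l))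

down-edges : ∀ a l → EdgeBlock descending a l (down a (suc l))
down-edges a l = block (edge a l)
  where
  edge : ∀ a l i → i < l → Edge descending (a + i) (down a (suc l))
  edge a (suc l) i i<1+l with m≤n⇒m<n∨m≡n i<1+l
  ... | inj₁ (s≤s i<l) = there (edge a l i i<l)
  ... | inj₂ refl      = subst (λ t → Adj t (a + i) (down a (suc (suc i)))) (+-suc a i) here

edgeBlock-++⁺ˡ : ∀ {o a l xs} ys → EdgeBlock o a l xs → EdgeBlock o a l (xs ++ ys)
edgeBlock-++⁺ˡ ys (block edgeAt) = block λ i i<l → adj-++⁺ˡ ys (edgeAt i i<l)

edgeBlock-++⁺ʳ : ∀ {o a l xs} ys → EdgeBlock o a l xs → EdgeBlock o a l (ys ++ xs)
edgeBlock-++⁺ʳ ys (block edgeAt) = block λ i i<l → adj-++⁺ʳ ys (edgeAt i i<l)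

block-frame : ∀ {p b s o low xs} →
  Realization (low + suc p * 2) (theList (suc p * 2) b s) xs →
  EdgeBlock o low (suc p * 2) xs → Frame p b s (suc p) o
block-frame {low = low} {xs} R (block edgeAt) = record
  { low         = low
  ; list        = xs
  ; realization = R
  ; xEdges      = λ j j<1+p → edgeAt (suc (j * 2)) (*-monoˡ-≤ 2 j<1+p)
  ; sEdges      = λ j j<1+p → edgeAt (j * 2) (≤-trans (n≤1+n _) (*-monoˡ-≤ 2 j<1+p))
  }

∣1+n+n-n∣≡1+n : ∀ n → ∣ suc n + n - n ∣ ≡ suc n
∣1+n+n-n∣≡1+n n =
  trans (∣-∣-comm (suc n + n) n) (trans (cong ∣ n -_∣ (+-comm (suc n) n)) (∣m-m+n∣≡n n (suc n)))

straight : ∀ n → Realization n (replicate n 1) (up 0 (suc n))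
straight n = record
  { covers      = ↭-reflexive (sym (upTo-up (suc n)))
  ; differences = ↭-reflexive (diffs-up 0 n)
  ; startsAt0   = _ , refl
  }

zigzag : ∀ a l →
  Realization (suc (a + l)) (suc l ∷ replicate (a + l) 1) (up 0 (suc a) ++ down (suc a) (suc l))
zigzag a l = record
  { covers      = covers
  ; differences = differences
  ; startsAt0   = _ , refl
  }
  where
  open PermutationReasoning
  covers : up 0 (suc a) ++ down (suc a) (suc l) ↭ upTo (suc (suc (a + l)))
  covers = begin
    up 0 (suc a) ++ down (suc a) (suc l)  ↭⟨ ++⁺ˡ (up 0 (suc a)) (down↭up (suc a) (suc l)) ⟩
    up 0 (suc a) ++ up (suc a) (suc l)    ≡⟨ sym (up-++ 0 (suc a) (suc l)) ⟩
    up 0 (suc a + suc l)                  ≡⟨ cong (λ t → up 0 (suc t)) (+-suc a l) ⟩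
    up 0 (suc (suc (a + l)))              ≡⟨ sym (upTo-up _) ⟩
    upTo (suc (suc (a + l)))              ∎
  jump : ∣ a - suc a + l ∣ ≡ suc l
  jump = trans (cong ∣ a -_∣ (sym (+-suc a l))) (∣m-m+n∣≡n a (suc l))
  differences : diffs (up 0 (suc a) ++ down (suc a) (suc l)) ↭ suc l ∷ replicate (a + l) 1
  differences = begin
    diffs (up 0 (suc a) ++ down (suc a) (suc l))
      ≡⟨ diffs-up-++ 0 a _ ⟩
    replicate a 1 ++ ∣ a - suc a + l ∣ ∷ diffs (down (suc a) (suc l))
      ≡⟨ cong₂ (λ δ D → replicate a 1 ++ δ ∷ D) jump (diffs-down (suc a) l) ⟩
    replicate a 1 ++ [ suc l ] ++ replicate l 1
      ↭⟨ shift (suc l) (replicate a 1) _ ⟩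
    suc l ∷ replicate a 1 ++ replicate l 1
      ≡⟨ cong (suc l ∷_) (replicate-++ a l 1) ⟩
    suc l ∷ replicate (a + l) 1 ∎

zigzag-edges : ∀ a l → EdgeBlock descending (suc a) l (up 0 (suc a) ++ down (suc a) (suc l))
zigzag-edges a l = edgeBlock-++⁺ʳ (up 0 (suc a)) (down-edges (suc a) l)

-- (b, s) = (0, 0): the straight run 0, ..., 2x-1, offset x-1.
frame00 : ∀ p → Frame p 0 0 (suc p) ascending
frame00 p = block-frame (retarget (↭-sym (theList-↭ y 0 0)) (straight (y + x)))
                        (block λ i i<x → EdgeBlock.edgeAt (up-edges 0 (y + x)) (y + i) (+-monoʳ-< y i<x))
  where
  y x : ℕ
  y = suc (p * 2)
  x = suc y

-- (b, s) = (0, 1): the zigzag 0, ..., x-1, 2x, ..., x, offset x.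
frame01 : ∀ p → Frame p 0 1 (suc p) descending
frame01 p = block-frame (retarget (↭-sym (theList-↭ y 0 1)) (zigzag y x)) (zigzag-edges y x)
  where
  y x : ℕ
  y = suc (p * 2)
  x = suc y

-- (b, s) = (1, 0): the zigzag 0, ..., x, 2x, ..., x+1, offset x, carrying
-- only the x-edges x+1, x+3, ..., 2x-1.
frame10 : ∀ p → Frame p 1 0 0 descending
frame10 p = record
  { low         = x
  ; list        = zig
  ; realization = subst (λ n → Realization n (theList x 1 0) zig) (sym (+-suc x y))
                        (retarget (↭-trans (↭-reflexive (cong (λ t → x ∷ replicate t 1) (+-comm x y)))
                                           (↭-sym (theList-↭ y 1 0)))
                                  (zigzag x y))
  ; xEdges      = λ { j (s≤s j≤p) → subst (λ t → Edge descending t zig) (sym (+-suc x (j * 2)))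
                                          (EdgeBlock.edgeAt (zigzag-edges x y) (j * 2) (s≤s (*-monoˡ-≤ 2 j≤p))) }
  ; sEdges      = λ _ ()
  }
  where
  y x : ℕ
  y = suc (p * 2)
  x = suc y
  zig : List ℕ
  zig = up 0 (suc x) ++ down (suc x) (suc y)

-- (b, s) = (1, 1): 0, 1, x+1, ..., 2x+1, x, ..., 2, offset x+1.
frame11 : ∀ p → Frame p 1 1 (suc p) ascending
frame11 p = block-frame {low = suc x} (retarget (↭-sym (theList-↭ y 1 1)) realization)
                        (edgeBlock-++⁺ʳ (up 0 2) (edgeBlock-++⁺ˡ (down 2 y) (up-edges (suc x) x)))
  where
  w y x : ℕ
  w = p * 2
  y = suc w
  x = suc y
  open PermutationReasoning
  total : ∀ y → 2 + (y + suc (suc y)) ≡ suc (suc (suc y) + suc y)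
  total = solve-∀
  ones : 1 ∷ replicate x 1 ++ replicate w 1 ≡ replicate (y + x) 1
  ones = trans (cong (1 ∷_) (replicate-++ x w 1)) (cong (λ t → replicate (suc t) 1) (+-comm x w))
  realization : Realization (suc x + x) (x ∷ suc x ∷ replicate (y + x) 1)
                            (up 0 2 ++ up (suc x) (suc x) ++ down 2 y)
  realization = record
    { covers = begin
        up 0 2 ++ up (suc x) (suc x) ++ down 2 y
          ↭⟨ ++⁺ˡ (up 0 2) (++⁺ˡ (up (suc x) (suc x)) (down↭up 2 y)) ⟩
        up 0 2 ++ up (suc x) (suc x) ++ up 2 y
          ↭⟨ ++⁺ˡ (up 0 2) (↭-++-comm (up (suc x) (suc x)) (up 2 y)) ⟩
        up 0 2 ++ up 2 y ++ up (suc x) (suc x)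
          ≡⟨ cong (up 0 2 ++_) (sym (up-++ 2 y (suc x))) ⟩
        up 0 2 ++ up 2 (y + suc x)
          ≡⟨ sym (up-++ 0 2 (y + suc x)) ⟩
        up 0 (2 + (y + suc x))
          ≡⟨ cong (up 0) (total y) ⟩
        up 0 (suc (suc x + x))
          ≡⟨ sym (upTo-up _) ⟩
        upTo (suc (suc x + x)) ∎
    ; differences = begin
        1 ∷ x ∷ diffs (up (suc x) (suc x) ++ down 2 y)
          ≡⟨ cong (λ t → 1 ∷ x ∷ t) (diffs-up-++ (suc x) x (down 2 y)) ⟩
        1 ∷ x ∷ replicate x 1 ++ ∣ suc x + x - x ∣ ∷ diffs (down 2 y)
          ≡⟨ cong₂ (λ δ D → 1 ∷ x ∷ replicate x 1 ++ δ ∷ D) (∣1+n+n-n∣≡1+n x) (diffs-down 2 w) ⟩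
        1 ∷ x ∷ replicate x 1 ++ [ suc x ] ++ replicate w 1
          ↭⟨ ↭-swap 1 x ↭-refl ⟩
        x ∷ (1 ∷ replicate x 1) ++ [ suc x ] ++ replicate w 1
          ↭⟨ ↭-prep x (shift (suc x) (1 ∷ replicate x 1) (replicate w 1)) ⟩
        x ∷ suc x ∷ 1 ∷ replicate x 1 ++ replicate w 1
          ≡⟨ cong (λ t → x ∷ suc x ∷ t) ones ⟩
        x ∷ suc x ∷ replicate (y + x) 1 ∎
    ; startsAt0 = _ , refl
    }

-- (b, s) = (1, 2): 0, x, ..., 1, x+2, ..., 2x+2, x+1, offset x+2.
frame12 : ∀ p → Frame p 1 2 (suc p) ascending
frame12 p = block-frame {low = suc (suc x)} (retarget (↭-sym (theList-↭ y 1 2)) realization)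
                        (edgeBlock-++⁺ʳ (0 ∷ down 1 x) (edgeBlock-++⁺ˡ [ suc x ] (up-edges (suc (suc x)) x)))
  where
  y x : ℕ
  y = suc (p * 2)
  x = suc y
  open PermutationReasoning
  upper : List ℕ
  upper = up (suc (suc x)) (suc x) ++ [ suc x ]
  realization : Realization (suc (suc x) + x) (x ∷ suc x ∷ suc x ∷ replicate (y + x) 1)
                            (0 ∷ down 1 x ++ upper)
  realization = record
    { covers = begin
        0 ∷ down 1 x ++ upper
          ↭⟨ ↭-prep 0 (++⁺ʳ upper (down↭up 1 x)) ⟩
        0 ∷ up 1 x ++ upper
          ↭⟨ ↭-prep 0 (++⁺ˡ (up 1 x) (↭-sym (∷↭∷ʳ (suc x) (up (suc (suc x)) (suc x))))) ⟩
        0 ∷ up 1 x ++ up (suc x) (suc (suc x))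
          ≡⟨ cong (0 ∷_) (sym (up-++ 1 x (suc (suc x)))) ⟩
        up 0 (suc (x + suc (suc x)))
          ≡⟨ cong (λ t → up 0 (suc t)) (+-comm x (suc (suc x))) ⟩
        up 0 (suc (suc (suc x) + x))
          ≡⟨ sym (upTo-up _) ⟩
        upTo (suc (suc (suc x) + x)) ∎
    ; differences = begin
        x ∷ diffs (down 1 x ++ upper)
          ≡⟨ cong (x ∷_) (diffs-down-++ 1 y upper) ⟩
        x ∷ replicate y 1 ++ suc x ∷ diffs upper
          ≡⟨ cong (λ t → x ∷ replicate y 1 ++ suc x ∷ t) (diffs-up-++ (suc (suc x)) x [ suc x ]) ⟩
        x ∷ replicate y 1 ++ suc x ∷ replicate x 1 ++ ∣ suc x + x - x ∣ ∷ []
          ≡⟨ cong (λ δ → x ∷ replicate y 1 ++ suc x ∷ replicate x 1 ++ δ ∷ []) (∣1+n+n-n∣≡1+n x) ⟩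
        x ∷ replicate y 1 ++ [ suc x ] ++ replicate x 1 ++ [ suc x ]
          ↭⟨ ↭-prep x (shift (suc x) (replicate y 1) _) ⟩
        x ∷ suc x ∷ replicate y 1 ++ replicate x 1 ++ [ suc x ]
          ≡⟨ cong (λ t → x ∷ suc x ∷ t) (sym (++-assoc (replicate y 1) (replicate x 1) [ suc x ])) ⟩
        x ∷ suc x ∷ (replicate y 1 ++ replicate x 1) ∷ʳ suc x
          ↭⟨ ↭-prep x (↭-prep (suc x) (↭-sym (∷↭∷ʳ (suc x) _))) ⟩
        x ∷ suc x ∷ suc x ∷ replicate y 1 ++ replicate x 1
          ≡⟨ cong (λ t → x ∷ suc x ∷ suc x ∷ t) (replicate-++ y x 1) ⟩
        x ∷ suc x ∷ suc x ∷ replicate (y + x) 1 ∎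
    ; startsAt0 = _ , refl
    }

data Halving : ℕ → Set where
  even : ∀ h → Halving (h * 2 + 0)
  odd  : ∀ h → Halving (h * 2 + 1)

halving : ∀ n → Halving n
halving zero          = even 0
halving (suc zero)    = odd 0
halving (suc (suc n)) with halving n
... | even h = even (suc h)
... | odd  h = odd (suc h)

half : ∀ {σ r q} → σ * 2 + r ≤ q * 2 → σ ≤ q
half {σ} {r} {q} le = *-cancelʳ-≤ σ q 2 (≤-trans (m≤m+n (σ * 2) r) le)

odd-even : ∀ p β σ → σ ≤ suc p →
  Σ (List ℕ) (StandardLinearRealization (theList (suc p * 2) (β * 2 + 1) (σ * 2 + 0)))
odd-even p β zero    _         = complete β 0 z≤n (frame10 p)
odd-even p β (suc σ) 1+σ≤1+p =
  subst (λ t → Σ (List ℕ) (StandardLinearRealization (theList (suc p * 2) (β * 2 + 1) t)))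
        (two-more σ) (complete β σ (≤-trans (n≤1+n σ) 1+σ≤1+p) (frame12 p))
  where
  two-more : ∀ σ → σ * 2 + 2 ≡ suc σ * 2 + 0
  two-more = solve-∀

-- The theorem.  The hypothesis 4 ≤ x only excludes x = 0: the construction
-- works for every positive even x.
proposition3p15 : (x : ℕ) → 4 ≤ x → 2 ∣ x → (b s : ℕ) → s ≤ x →
    Σ (List ℕ) (λ xs → StandardLinearRealization (theList x b s) xs)
proposition3p15 .(0 * 2)     ()  (divides zero refl)    b s s≤x
proposition3p15 .(suc p * 2) _ (divides (suc p) refl) b s s≤x with halving b | halving s
... | even β | even σ = complete β σ (half s≤x) (frame00 p)
... | even β | odd  σ = complete β σ (half s≤x) (frame01 p)
... | odd  β | odd  σ = complete β σ (half s≤x) (frame11 p)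
... | odd  β | even σ = odd-even p β σ (half s≤x)
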